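{- The class $(\mathcal K,\le)$ has the amalgamation property: for all $A,B,C\in\mathcal K$ with $A\le B$ and $A\le C$ (where $A$ is a subgraph of both $B$ and $C$), there exist $D\in\mathcal K$ and graph embeddings $f:B\to D$, $g:C\to D$ with $f|_A=g|_A$, $f(B)\le D$ and $g(C)\le D$.
   Context: Graphs are simple undirected graphs; subgraphs are induced subgraphs. For a graph $A$ and $x\in A$, $\mathrm{val}(x)$ is the number of neighbours of $x$ in $A$; $x$ is removable from $A$ if $\mathrm{val}(x)\le1$, or $\mathrm{val}(x)=2$ and the two neighbours of $x$ are adjacent. For a subgraph $A$ of $B$, $A\le B$ ($A$ strong in $B$) means that for every finite subgraph $B_0$ of $B$ the induced subgraph on $B_0\cup A$ has a removable vertex in $(B_0\cup A)\setminus A$. $\mathcal K$ is the class of finite graphs in which every edge is contained in at most two triangles and every subgraph has a removable vertex. -}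

module Defs where

open import Data.Nat using (ℕ; zero; suc; _+_; _≤_)
open import Data.Bool using (Bool; true; false; _∧_; _∨_; if_then_else_)
open import Data.Fin using (Fin; zero; suc; _≟_)
open import Data.Product using (Σ; ∃; _×_; _,_)
open import Data.Sum using (_⊎_)
open import Relation.Nullary using (¬_)
open import Relation.Nullary.Decidable using (⌊_⌋)
open import Relation.Binary.PropositionalEquality using (_≡_; _≢_)

record Graph : Set where
  field
    size    : ℕ
    adj     : Fin size → Fin size → Bool
    adj-sym : ∀ x y → adj x y ≡ adj y x
    adj-irr : ∀ x → adj x x ≡ false
open Graph public

-- Subsets of a finite vertex set (induced subgraphs are given by their vertex sets).
Sub : ℕ → Set
Sub n = Fin n → Bool

count : ∀ {n} → (Fin n → Bool) → ℕ
count {zero}  p = 0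
count {suc n} p = (if p zero then 1 else 0) + count (λ i → p (suc i))

anyF : ∀ {n} → (Fin n → Bool) → Bool
anyF {zero}  p = false
anyF {suc n} p = p zero ∨ anyF (λ i → p (suc i))

val : (G : Graph) → Sub (size G) → Fin (size G) → ℕ
val G X x = count (λ y → X y ∧ adj G x y)

-- x is removable from the induced subgraph on X (membership of x in X stated separately)
Removable : (G : Graph) → Sub (size G) → Fin (size G) → Set
Removable G X x =
  val G X x ≤ 1 ⊎
  (val G X x ≡ 2 ×
   Σ (Fin (size G)) λ y → Σ (Fin (size G)) λ z →
     y ≢ z × X y ≡ true × X z ≡ true ×
     adj G x y ≡ true × adj G x z ≡ true × adj G y z ≡ true)

HasRemovable : (G : Graph) → Sub (size G) → Set
HasRemovable G X = Σ (Fin (size G)) λ x → X x ≡ true × Removable G X x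

Nonempty : ∀ {n} → Sub n → Set
Nonempty {n} X = Σ (Fin n) λ x → X x ≡ true

InK : Graph → Set
InK G =
  (∀ x y → adj G x y ≡ true → count (λ z → adj G x z ∧ adj G y z) ≤ 2) ×
  (∀ (X : Sub (size G)) → Nonempty X → HasRemovable G X)

-- A ≤ G for the subgraph of G with vertex set A: for every B₀ ⊆ G with B₀ ⊈ A,
-- the induced subgraph on B₀ ∪ A has a removable vertex in (B₀ ∪ A) \ A.
Strong : (G : Graph) → Sub (size G) → Set
Strong G A =
  ∀ (B₀ : Sub (size G)) →
  (Σ (Fin (size G)) λ x → B₀ x ≡ true × A x ≡ false) →
  Σ (Fin (size G)) λ x → (B₀ x ∨ A x) ≡ true × A x ≡ false ×
    Removable G (λ v → B₀ v ∨ A v) x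

record Emb (G H : Graph) : Set where
  field
    fun      : Fin (size G) → Fin (size H)
    inj      : ∀ x y → fun x ≡ fun y → x ≡ y
    adj-pres : ∀ x y → adj H (fun x) (fun y) ≡ adj G x y
open Emb public

image : ∀ {G H} → Emb G H → Sub (size H)
image e v = anyF (λ x → ⌊ fun e x ≟ v ⌋)

module Submission where

-- Induction on the number of vertices of C outside A.  As A ≤ C, some c ∉ A is
-- removable from C; deleting it leaves A ≤ C - c, so B and C - c amalgamate into
-- some D' by induction, and it remains to put c back over D'.  The neighbours of c
-- form a set N with |N| ≤ 1, or an edge yz.  If a new vertex with neighbourhood N
-- keeps every edge in at most two triangles, adjoin it freely.  Otherwise yz already
-- lies in triangles yzp and yzq of D'; one of p, q is outside C - c (else yz would
-- lie in three triangles of C), and c is identified with it.  Both constructions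
-- keep the old graph strong, and strongness is transitive.

open import Defs
open import Data.Nat using (ℕ; zero; suc; _+_; _≤_; z≤n; s≤s; _≤?_)
open import Data.Nat.Properties using (≤-trans; ≤-reflexive; +-suc; ≤-antisym; ≰⇒>; suc-injective)
open import Data.Bool using (Bool; true; false; _∧_; _∨_; not; if_then_else_)
open import Data.Bool.Properties using (not-injective; ∧-identityʳ; ∨-assoc)
open import Data.Fin using (Fin; zero; suc; _≟_; punchIn; punchOut)
open import Data.Fin.Properties using (0≢1+n; punchIn-injective; punchInᵢ≢i; punchIn-punchOut)
  renaming (suc-injective to fsuc-injective)
open import Data.Product using (Σ; ∃; _×_; _,_; proj₁; proj₂)
open import Data.Sum using (_⊎_; inj₁; inj₂)
open import Data.Empty using (⊥; ⊥-elim)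
open import Function using (_$_)
open import Relation.Nullary using (¬_; Dec; yes; no)
open import Relation.Nullary.Decidable using (⌊_⌋)
open import Relation.Binary.PropositionalEquality
  using (_≡_; _≢_; refl; sym; trans; cong; cong₂; subst; module ≡-Reasoning)

private variable
  n : ℕ

true≢false : ∀ {a} → a ≡ true → a ≡ false → ⊥
true≢false refl ()

¬true⇒false : ∀ {a} → ¬ (a ≡ true) → a ≡ false
¬true⇒false {true}  h = ⊥-elim (h refl)
¬true⇒false {false} h = refl

not-true⇒false : ∀ {a} → not a ≡ true → a ≡ false
not-true⇒false = not-injective

bool-ext : ∀ {a b} → (a ≡ true → b ≡ true) → (b ≡ true → a ≡ true) → a ≡ b
bool-ext {true}  {true}  f g = refl
bool-ext {true}  {false} f g = sym (f refl)
bool-ext {false} {true}  f g = g refl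
bool-ext {false} {false} f g = refl

∧-elim : ∀ {a b} → a ∧ b ≡ true → a ≡ true × b ≡ true
∧-elim {true} {true} _ = refl , refl

∧-intro : ∀ {a b} → a ≡ true → b ≡ true → a ∧ b ≡ true
∧-intro refl refl = refl

∧-swap : ∀ {a b} → a ∧ b ≡ true → b ∧ a ≡ true
∧-swap {true} {true} _ = refl

∨-elim : ∀ {a b} → a ∨ b ≡ true → a ≡ true ⊎ b ≡ true
∨-elim {true}  _ = inj₁ refl
∨-elim {false} e = inj₂ e

∨-introˡ : ∀ {a} b → a ≡ true → a ∨ b ≡ true
∨-introˡ b refl = refl

∨-introʳ : ∀ a {b} → b ≡ true → a ∨ b ≡ true
∨-introʳ true  _ = refl
∨-introʳ false e = e

≟-true⇒≡ : {a b : Fin n} → ⌊ a ≟ b ⌋ ≡ true → a ≡ b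
≟-true⇒≡ {a = a} {b} e with a ≟ b
... | yes p = p

≡⇒≟-true : {a b : Fin n} → a ≡ b → ⌊ a ≟ b ⌋ ≡ true
≡⇒≟-true {a = a} {b} eq with a ≟ b
... | yes _  = refl
... | no a≢b = ⊥-elim (a≢b eq)

≢⇒≟-false : {a b : Fin n} → a ≢ b → ⌊ a ≟ b ⌋ ≡ false
≢⇒≟-false {a = a} {b} a≢b with a ≟ b
... | yes eq = ⊥-elim (a≢b eq)
... | no _   = refl

Holds : (Fin n → Bool) → Fin n → Set
Holds p a = p a ≡ true

anyF-witness : (p : Fin n → Bool) → anyF p ≡ true → ∃ (Holds p)
anyF-witness {suc n} p e with p zero in eq
... | true  = zero , eq
... | false with anyF-witness (λ i → p (suc i)) e
...   | x , h = suc x , h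

anyF-intro : (p : Fin n → Bool) (x : Fin n) → p x ≡ true → anyF p ≡ true
anyF-intro p zero    e rewrite e = refl
anyF-intro p (suc x) e = ∨-introʳ (p zero) (anyF-intro (λ i → p (suc i)) x e)

find : (p : Fin n → Bool) → ∃ (Holds p) ⊎ (∀ x → p x ≡ false)
find {zero}  p = inj₂ λ ()
find {suc n} p with p zero in eq
... | true  = inj₁ (zero , eq)
... | false with find (λ i → p (suc i))
...   | inj₁ (x , h) = inj₁ (suc x , h)
...   | inj₂ h       = inj₂ λ { zero → eq ; (suc x) → h x }

img : ∀ {m} → (Fin m → Fin n) → Fin n → Bool
img f v = anyF (λ x → ⌊ f x ≟ v ⌋)

img-witness : ∀ {m} (f : Fin m → Fin n) v → img f v ≡ true → ∃ λ x → f x ≡ v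
img-witness f v e with anyF-witness _ e
... | x , h = x , ≟-true⇒≡ h

img-intro : ∀ {m} (f : Fin m → Fin n) x {v} → f x ≡ v → img f v ≡ true
img-intro f x {v} eq = anyF-intro _ x (≡⇒≟-true eq)

img-outside : ∀ {m} (f : Fin m → Fin n) v → (∀ x → f x ≢ v) → img f v ≡ false
img-outside f v h = ¬true⇒false λ e → let (x , fx≡v) = img-witness f v e in h x fx≡v

img-factor : ∀ {k m} (e : Fin m → Fin n) (g : Fin k → Fin m) (f : Fin k → Fin n) →
  (∀ x y → e x ≡ e y → x ≡ y) → (∀ a → e (g a) ≡ f a) → ∀ w → img f (e w) ≡ img g w
img-factor e g f e-inj e∘g≗f w = bool-ext
  (λ w∈ → let (a , fa≡ew) = img-witness f (e w) w∈ in
          img-intro g a (e-inj _ _ (trans (e∘g≗f a) fa≡ew)))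
  (λ w∈ → let (a , ga≡w) = img-witness g w w∈ in
          img-intro f a (trans (sym (e∘g≗f a)) (cong e ga≡w)))

imgSub : ∀ {m} → (Fin m → Fin n) → (Fin m → Bool) → Fin n → Bool
imgSub f X v = anyF (λ w → X w ∧ ⌊ f w ≟ v ⌋)

imgSub-witness : ∀ {m} (f : Fin m → Fin n) X v → imgSub f X v ≡ true →
  ∃ λ w → X w ≡ true × f w ≡ v
imgSub-witness f X v e with anyF-witness _ e
... | w , h = let (Xw , fw≡v) = ∧-elim {X w} h in w , Xw , ≟-true⇒≡ fw≡v

imgSub-injective : ∀ {m} (f : Fin m → Fin n) → (∀ x y → f x ≡ f y → x ≡ y) →
  ∀ X w → imgSub f X (f w) ≡ X w
imgSub-injective f f-inj X w = bool-ext
  (λ e → let (u , Xu , fu≡fw) = imgSub-witness f X (f w) e in subst (Holds X) (f-inj u w fu≡fw) Xu)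
  (λ e → anyF-intro _ w (∧-intro e (≡⇒≟-true refl)))

AtMostOne : (Fin n → Set) → Set
AtMostOne {n} P = ∀ (a b : Fin n) → P a → P b → a ≡ b

AtMostTwo : (Fin n → Set) → Set
AtMostTwo {n} P = ∀ (a b c : Fin n) → P a → P b → P c → a ≡ b ⊎ a ≡ c ⊎ b ≡ c

AtMostOne⇒AtMostTwo : {P : Fin n → Set} → AtMostOne P → AtMostTwo P
AtMostOne⇒AtMostTwo ≤1 a b c pa pb pc = inj₁ (≤1 a b pa pb)

count-cong : (p q : Fin n → Bool) → (∀ x → p x ≡ q x) → count p ≡ count q
count-cong {zero}  p q p≗q = refl
count-cong {suc n} p q p≗q rewrite p≗q zero =
  cong (_ +_) (count-cong (λ i → p (suc i)) (λ i → q (suc i)) (λ i → p≗q (suc i)))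

count-false : count {n} (λ _ → false) ≡ 0
count-false {zero}  = refl
count-false {suc n} = count-false {n}

remove : (Fin n → Bool) → Fin n → Fin n → Bool
remove p x v = p v ∧ not ⌊ v ≟ x ⌋

remove-intro : (p : Fin n → Bool) (x y : Fin n) → p y ≡ true → x ≢ y → remove p x y ≡ true
remove-intro p x y py x≢y rewrite py | ≢⇒≟-false (λ y≡x → x≢y (sym y≡x)) = refl

remove-elim : (p : Fin n → Bool) (x y : Fin n) → remove p x y ≡ true → p y ≡ true × x ≢ y
remove-elim p x y e =
  let (py , y≢x) = ∧-elim {p y} e
  in py , λ x≡y → true≢false (≡⇒≟-true (sym x≡y)) (not-true⇒false y≢x)

count-remove : (p : Fin n → Bool) (x : Fin n) → p x ≡ true → count p ≡ suc (count (remove p x))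
count-remove {suc n} p zero px rewrite px =
  cong suc (count-cong _ _ λ i → sym (∧-identityʳ (p (suc i))))
count-remove {suc n} p (suc x) px = begin
  hd (p zero) + count (λ i → p (suc i))
    ≡⟨ cong (hd (p zero) +_) (count-remove (λ i → p (suc i)) x px) ⟩
  hd (p zero) + suc (count (remove (λ i → p (suc i)) x))
    ≡⟨ +-suc (hd (p zero)) _ ⟩
  suc (hd (p zero) + count (remove (λ i → p (suc i)) x))
    ≡⟨ cong suc (cong₂ _+_ (cong hd (sym (∧-identityʳ (p zero))))
                           (count-cong _ _ λ i → cong (λ b → p (suc i) ∧ not b) (≟-suc i x))) ⟩
  suc (count (remove p (suc x))) ∎
  where
  open ≡-Reasoning
  hd : Bool → ℕ
  hd b = if b then 1 else 0
  ≟-suc : ∀ (i x : Fin n) → ⌊ i ≟ x ⌋ ≡ ⌊ suc i ≟ suc x ⌋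
  ≟-suc i x = bool-ext (λ e → ≡⇒≟-true (cong suc (≟-true⇒≡ e)))
                       (λ e → ≡⇒≟-true (fsuc-injective (≟-true⇒≡ e)))

count≥1 : (p : Fin n → Bool) (x : Fin n) → p x ≡ true → 1 ≤ count p
count≥1 p x px rewrite count-remove p x px = s≤s z≤n

count≥2 : (p : Fin n → Bool) (a b : Fin n) → p a ≡ true → p b ≡ true → a ≢ b → 2 ≤ count p
count≥2 p a b pa pb a≢b rewrite count-remove p a pa =
  s≤s (count≥1 (remove p a) b (remove-intro p a b pb a≢b))

count≥3 : (p : Fin n → Bool) (a b c : Fin n) → p a ≡ true → p b ≡ true → p c ≡ true →
  a ≢ b → a ≢ c → b ≢ c → 3 ≤ count p
count≥3 p a b c pa pb pc a≢b a≢c b≢c rewrite count-remove p a pa =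
  s≤s (count≥2 (remove p a) b c (remove-intro p a b pb a≢b) (remove-intro p a c pc a≢c) b≢c)

count≥1⇒witness : (p : Fin n → Bool) → 1 ≤ count p → ∃ (Holds p)
count≥1⇒witness {n} p 1≤count with find p
... | inj₁ witness = witness
... | inj₂ none with subst (1 ≤_) (trans (count-cong p _ none) (count-false {n})) 1≤count
...   | ()

count≥2⇒two : (p : Fin n → Bool) → 2 ≤ count p →
  Σ (Fin n) λ a → Σ (Fin n) λ b → a ≢ b × p a ≡ true × p b ≡ true
count≥2⇒two p 2≤count with count≥1⇒witness p (≤-trans (s≤s z≤n) 2≤count)
... | a , pa with count≥1⇒witness (remove p a) (pred-≤ (count-remove p a pa) 2≤count)
  where
  pred-≤ : ∀ {k m} → k ≡ suc m → 2 ≤ k → 1 ≤ m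
  pred-≤ refl (s≤s 1≤m) = 1≤m
...   | b , rb = let (pb , a≢b) = remove-elim p a b rb in a , b , a≢b , pa , pb

count≤1⇒AtMostOne : (p : Fin n → Bool) → count p ≤ 1 → AtMostOne (Holds p)
count≤1⇒AtMostOne p ≤1 a b pa pb with a ≟ b
... | yes a≡b = a≡b
... | no a≢b with ≤-trans (count≥2 p a b pa pb a≢b) ≤1
...   | s≤s ()

count≤2⇒AtMostTwo : (p : Fin n → Bool) → count p ≤ 2 → AtMostTwo (Holds p)
count≤2⇒AtMostTwo p ≤2 a b c pa pb pc with a ≟ b | a ≟ c | b ≟ c
... | yes a≡b | _       | _       = inj₁ a≡b
... | no _    | yes a≡c | _       = inj₂ (inj₁ a≡c)
... | no _    | no _    | yes b≡c = inj₂ (inj₂ b≡c)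
... | no a≢b  | no a≢c  | no b≢c with ≤-trans (count≥3 p a b c pa pb pc a≢b a≢c b≢c) ≤2
...   | s≤s (s≤s ())

AtMostOne⇒count≤1 : (p : Fin n → Bool) → AtMostOne (Holds p) → count p ≤ 1
AtMostOne⇒count≤1 {zero}  p ≤1 = z≤n
AtMostOne⇒count≤1 {suc n} p ≤1 with p zero in p0
... | true  = ≤-reflexive (cong suc (trans (count-cong _ _ rest) (count-false {n})))
  where
  rest : ∀ i → p (suc i) ≡ false
  rest i = ¬true⇒false λ psi → 0≢1+n (≤1 zero (suc i) p0 psi)
... | false = AtMostOne⇒count≤1 (λ i → p (suc i))
                λ a b pa pb → fsuc-injective (≤1 (suc a) (suc b) pa pb)

AtMostTwo⇒count≤2 : (p : Fin n → Bool) → AtMostTwo (Holds p) → count p ≤ 2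
AtMostTwo⇒count≤2 {zero}  p ≤2 = z≤n
AtMostTwo⇒count≤2 {suc n} p ≤2 with p zero in p0
... | true  = s≤s (AtMostOne⇒count≤1 (λ i → p (suc i))
                     λ a b pa pb → tail (≤2 zero (suc a) (suc b) p0 pa pb))
  where
  tail : ∀ {a b : Fin n} → zero ≡ suc a ⊎ zero ≡ suc b ⊎ suc a ≡ suc b → a ≡ b
  tail (inj₂ (inj₂ eq)) = fsuc-injective eq
... | false = AtMostTwo⇒count≤2 (λ i → p (suc i))
                λ a b c pa pb pc → tail (≤2 (suc a) (suc b) (suc c) pa pb pc)
  where
  tail : ∀ {a b c : Fin n} → suc a ≡ suc b ⊎ suc a ≡ suc c ⊎ suc b ≡ suc c →
         a ≡ b ⊎ a ≡ c ⊎ b ≡ c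
  tail (inj₁ eq)        = inj₁ (fsuc-injective eq)
  tail (inj₂ (inj₁ eq)) = inj₂ (inj₁ (fsuc-injective eq))
  tail (inj₂ (inj₂ eq)) = inj₂ (inj₂ (fsuc-injective eq))

-- Removable vertices and strong subsets

nbr : (G : Graph) → Sub (size G) → Fin (size G) → Fin (size G) → Bool
nbr G X x y = X y ∧ adj G x y

common : (G : Graph) → Fin (size G) → Fin (size G) → Fin (size G) → Bool
common G x y z = adj G x z ∧ adj G y z

-- x is removable from X iff its neighbourhood in X is a clique on at most two
-- vertices; InK′ and Strong′ restate InK and Strong in these terms.
IsEdge : (G : Graph) → (Fin (size G) → Set) → Set
IsEdge G P = Σ (Fin (size G)) λ y → Σ (Fin (size G)) λ z →
  y ≢ z × P y × P z × adj G y z ≡ true × (∀ w → P w → w ≡ y ⊎ w ≡ z)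

SmallClique : (G : Graph) → (Fin (size G) → Set) → Set
SmallClique G P = AtMostOne P ⊎ IsEdge G P

Removable′ : (G : Graph) → Sub (size G) → Fin (size G) → Set
Removable′ G X x = SmallClique G (Holds (nbr G X x))

HasRemovable′ : (G : Graph) → Sub (size G) → Set
HasRemovable′ G X = Σ (Fin (size G)) λ x → X x ≡ true × Removable′ G X x

InK′ : Graph → Set
InK′ G =
  (∀ x y → adj G x y ≡ true → AtMostTwo (Holds (common G x y))) ×
  (∀ (X : Sub (size G)) → Nonempty X → HasRemovable′ G X)

RemovableOutside : (G : Graph) → Sub (size G) → Sub (size G) → Set
RemovableOutside G A B₀ =
  Σ (Fin (size G)) λ x → (B₀ x ∨ A x) ≡ true × A x ≡ false × Removable′ G (λ v → B₀ v ∨ A v) x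

Strong′ : (G : Graph) → Sub (size G) → Set
Strong′ G A =
  ∀ (B₀ : Sub (size G)) → (Σ (Fin (size G)) λ x → B₀ x ≡ true × A x ≡ false) →
  RemovableOutside G A B₀

AtMostTwo-within : ∀ {P : Fin n → Set} y z → (∀ w → P w → w ≡ y ⊎ w ≡ z) → AtMostTwo P
AtMostTwo-within y z within a b c pa pb pc = pigeonhole (within a pa) (within b pb) (within c pc)
  where
  pigeonhole : ∀ {a b c : Fin _} → a ≡ y ⊎ a ≡ z → b ≡ y ⊎ b ≡ z → c ≡ y ⊎ c ≡ z →
               a ≡ b ⊎ a ≡ c ⊎ b ≡ c
  pigeonhole (inj₁ refl) (inj₁ refl) _           = inj₁ refl
  pigeonhole (inj₁ refl) (inj₂ refl) (inj₁ refl) = inj₂ (inj₁ refl)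
  pigeonhole (inj₁ refl) (inj₂ refl) (inj₂ refl) = inj₂ (inj₂ refl)
  pigeonhole (inj₂ refl) (inj₁ refl) (inj₁ refl) = inj₂ (inj₂ refl)
  pigeonhole (inj₂ refl) (inj₁ refl) (inj₂ refl) = inj₂ (inj₁ refl)
  pigeonhole (inj₂ refl) (inj₂ refl) _           = inj₁ refl

Removable⇒Removable′ : ∀ G X x → Removable G X x → Removable′ G X x
Removable⇒Removable′ G X x (inj₁ val≤1) = inj₁ (count≤1⇒AtMostOne _ val≤1)
Removable⇒Removable′ G X x (inj₂ (val≡2 , y , z , y≢z , Xy , Xz , xy , xz , yz)) =
  inj₂ (y , z , y≢z , ∧-intro Xy xy , ∧-intro Xz xz , yz , within)
  where
  within : ∀ w → Holds (nbr G X x) w → w ≡ y ⊎ w ≡ z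
  within w nw with count≤2⇒AtMostTwo (nbr G X x) (≤-reflexive val≡2)
                     y z w (∧-intro Xy xy) (∧-intro Xz xz) nw
  ... | inj₁ y≡z        = ⊥-elim (y≢z y≡z)
  ... | inj₂ (inj₁ y≡w) = inj₁ (sym y≡w)
  ... | inj₂ (inj₂ z≡w) = inj₂ (sym z≡w)

Removable′⇒Removable : ∀ G X x → Removable′ G X x → Removable G X x
Removable′⇒Removable G X x (inj₁ ≤1) = inj₁ (AtMostOne⇒count≤1 _ ≤1)
Removable′⇒Removable G X x (inj₂ (y , z , y≢z , ny , nz , yz , within)) =
  inj₂ (≤-antisym (AtMostTwo⇒count≤2 _ (AtMostTwo-within y z within)) (count≥2 _ y z ny nz y≢z) ,
        y , z , y≢z , proj₁ (∧-elim {X y} ny) , proj₁ (∧-elim {X z} nz) ,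
        proj₂ (∧-elim {X y} ny) , proj₂ (∧-elim {X z} nz) , yz)

InK⇒InK′ : ∀ G → InK G → InK′ G
InK⇒InK′ G (triangles , removable) =
  (λ x y xy → count≤2⇒AtMostTwo _ (triangles x y xy)) ,
  λ X ne → let (x , Xx , r) = removable X ne in x , Xx , Removable⇒Removable′ G X x r

InK′⇒InK : ∀ G → InK′ G → InK G
InK′⇒InK G (triangles , removable) =
  (λ x y xy → AtMostTwo⇒count≤2 _ (triangles x y xy)) ,
  λ X ne → let (x , Xx , r) = removable X ne in x , Xx , Removable′⇒Removable G X x r

Strong⇒Strong′ : ∀ G A → Strong G A → Strong′ G A
Strong⇒Strong′ G A strong B₀ outside =
  let (x , inS , ∉A , r) = strong B₀ outside in x , inS , ∉A , Removable⇒Removable′ G _ x r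

Strong′⇒Strong : ∀ G A → Strong′ G A → Strong G A
Strong′⇒Strong G A strong B₀ outside =
  let (x , inS , ∉A , r) = strong B₀ outside in x , inS , ∉A , Removable′⇒Removable G _ x r

SmallClique-⊆ : ∀ G (p q : Fin (size G) → Bool) → (∀ v → Holds p v → Holds q v) →
  SmallClique G (Holds q) → SmallClique G (Holds p)
SmallClique-⊆ G p q p⊆q (inj₁ ≤1) = inj₁ λ a b pa pb → ≤1 a b (p⊆q a pa) (p⊆q b pb)
SmallClique-⊆ G p q p⊆q (inj₂ (y , z , y≢z , qy , qz , yz , within)) with p y in py | p z in pz
... | true  | true  = inj₂ (y , z , y≢z , py , pz , yz , λ w pw → within w (p⊆q w pw))
... | false | _     = inj₁ λ a b pa pb → trans (only-z a pa) (sym (only-z b pb))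
  where
  only-z : ∀ a → Holds p a → a ≡ z
  only-z a pa with within a (p⊆q a pa)
  ... | inj₁ refl = ⊥-elim (true≢false pa py)
  ... | inj₂ a≡z  = a≡z
... | true  | false = inj₁ λ a b pa pb → trans (only-y a pa) (sym (only-y b pb))
  where
  only-y : ∀ a → Holds p a → a ≡ y
  only-y a pa with within a (p⊆q a pa)
  ... | inj₂ refl = ⊥-elim (true≢false pa pz)
  ... | inj₁ a≡y  = a≡y

SmallClique-pair : ∀ G {P : Fin (size G) → Set} X Y → SmallClique G P → P X → P Y → X ≢ Y →
  ∀ w → P w → w ≡ X ⊎ w ≡ Y
SmallClique-pair G X Y (inj₁ ≤1) pX pY X≢Y w pw = ⊥-elim (X≢Y (≤1 X Y pX pY))
SmallClique-pair G X Y (inj₂ (y , z , _ , _ , _ , _ , within)) pX pY X≢Y w pw =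
  relabel (within X pX) (within Y pY) (within w pw)
  where
  relabel : X ≡ y ⊎ X ≡ z → Y ≡ y ⊎ Y ≡ z → w ≡ y ⊎ w ≡ z → w ≡ X ⊎ w ≡ Y
  relabel (inj₁ refl) (inj₁ refl) _           = ⊥-elim (X≢Y refl)
  relabel (inj₂ refl) (inj₂ refl) _           = ⊥-elim (X≢Y refl)
  relabel (inj₁ refl) (inj₂ refl) (inj₁ refl) = inj₁ refl
  relabel (inj₁ refl) (inj₂ refl) (inj₂ refl) = inj₂ refl
  relabel (inj₂ refl) (inj₁ refl) (inj₁ refl) = inj₂ refl
  relabel (inj₂ refl) (inj₁ refl) (inj₂ refl) = inj₁ refl

Removable′-⊆ : ∀ G X Y x → (∀ v → adj G x v ≡ true → X v ≡ true → Y v ≡ true) →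
  Removable′ G Y x → Removable′ G X x
Removable′-⊆ G X Y x X⊆Y = SmallClique-⊆ G (nbr G X x) (nbr G Y x) λ v n →
  let (Xv , xv) = ∧-elim {X v} n in ∧-intro (X⊆Y v xv Xv) xv

Strong′-cong : ∀ G P Q → (∀ v → P v ≡ Q v) → Strong′ G P → Strong′ G Q
Strong′-cong G P Q P≗Q strong B₀ (w , B₀w , Qw) with strong B₀ (w , B₀w , trans (P≗Q w) Qw)
... | x , inS , Px , r =
  x , subst (λ t → (B₀ x ∨ t) ≡ true) (P≗Q x) inS , trans (sym (P≗Q x)) Px ,
  Removable′-⊆ G _ _ x (λ v _ inS′ → subst (λ t → (B₀ v ∨ t) ≡ true) (sym (P≗Q v)) inS′) r

idᴱ : ∀ {G} → Emb G G
idᴱ = record { fun = λ x → x ; inj = λ x y eq → eq ; adj-pres = λ x y → refl }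

_∘ᴱ_ : ∀ {G H K} → Emb H K → Emb G H → Emb G K
h ∘ᴱ f = record { fun      = λ x → fun h (fun f x)
                ; inj      = λ x y eq → inj f x y (inj h _ _ eq)
                ; adj-pres = λ x y → trans (adj-pres h _ _) (adj-pres f x y) }

module RemovableAlong {G H : Graph} (e : Emb G H) (X : Sub (size G)) (Y : Sub (size H))
  (Y∘e≗X : ∀ w → Y (fun e w) ≡ X w)
  (Y⊆image : ∀ v → Y v ≡ true → ∃ λ w → fun e w ≡ v) where

  nbr-e : ∀ x w → nbr H Y (fun e x) (fun e w) ≡ nbr G X x w
  nbr-e x w = cong₂ _∧_ (Y∘e≗X w) (adj-pres e x w)

  nbr⊆image : ∀ x v → Holds (nbr H Y (fun e x)) v → ∃ λ w → fun e w ≡ v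
  nbr⊆image x v n = Y⊆image v (proj₁ (∧-elim {Y v} n))

  push : ∀ x → Removable′ G X x → Removable′ H Y (fun e x)
  push x (inj₁ ≤1) = inj₁ λ a b na nb → unique (nbr⊆image x a na) (nbr⊆image x b nb) na nb
    where
    unique : ∀ {a b} → ∃ (λ w → fun e w ≡ a) → ∃ (λ w → fun e w ≡ b) →
             Holds (nbr H Y (fun e x)) a → Holds (nbr H Y (fun e x)) b → a ≡ b
    unique (wa , refl) (wb , refl) na nb =
      cong (fun e) (≤1 wa wb (trans (sym (nbr-e x wa)) na) (trans (sym (nbr-e x wb)) nb))
  push x (inj₂ (y , z , y≢z , ny , nz , yz , within)) =
    inj₂ (fun e y , fun e z , (λ eq → y≢z (inj e y z eq)) ,
          trans (nbr-e x y) ny , trans (nbr-e x z) nz , trans (adj-pres e y z) yz , within′)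
    where
    within′ : ∀ v → Holds (nbr H Y (fun e x)) v → v ≡ fun e y ⊎ v ≡ fun e z
    within′ v nv with nbr⊆image x v nv
    ... | w , refl with within w (trans (sym (nbr-e x w)) nv)
    ...   | inj₁ w≡y = inj₁ (cong (fun e) w≡y)
    ...   | inj₂ w≡z = inj₂ (cong (fun e) w≡z)

  pull : ∀ x → Removable′ H Y (fun e x) → Removable′ G X x
  pull x (inj₁ ≤1) =
    inj₁ λ a b na nb → inj e a b (≤1 _ _ (trans (nbr-e x a) na) (trans (nbr-e x b) nb))
  pull x (inj₂ (y , z , y≢z , ny , nz , yz , within))
    with nbr⊆image x y ny | nbr⊆image x z nz
  ... | y′ , refl | z′ , refl =
    inj₂ (y′ , z′ , (λ eq → y≢z (cong (fun e) eq)) ,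
          trans (sym (nbr-e x y′)) ny , trans (sym (nbr-e x z′)) nz ,
          trans (sym (adj-pres e y′ z′)) yz , within′)
    where
    within′ : ∀ w → Holds (nbr G X x) w → w ≡ y′ ⊎ w ≡ z′
    within′ w nw with within (fun e w) (trans (nbr-e x w) nw)
    ... | inj₁ eq = inj₁ (inj e _ _ eq)
    ... | inj₂ eq = inj₂ (inj e _ _ eq)

imgSub-⊆image : ∀ {G H} (e : Emb G H) X v → imgSub (fun e) X v ≡ true → ∃ λ w → fun e w ≡ v
imgSub-⊆image e X v inY = let (w , _ , ew≡v) = imgSub-witness (fun e) X v inY in w , ew≡v

common-emb : ∀ {G H} (e : Emb G H) x y z → common H (fun e x) (fun e y) (fun e z) ≡ common G x y z
common-emb e x y z = cong₂ _∧_ (adj-pres e x z) (adj-pres e y z)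

InK′-hereditary : ∀ {G H} → Emb G H → InK′ H → InK′ G
InK′-hereditary {G} {H} e (triangles , removable) = triangles′ , removable′
  where
  triangles′ : ∀ x y → adj G x y ≡ true → AtMostTwo (Holds (common G x y))
  triangles′ x y xy a b c ca cb cc
    with triangles (fun e x) (fun e y) (trans (adj-pres e x y) xy) (fun e a) (fun e b) (fun e c)
           (trans (common-emb e x y a) ca) (trans (common-emb e x y b) cb) (trans (common-emb e x y c) cc)
  ... | inj₁ eq        = inj₁ (inj e _ _ eq)
  ... | inj₂ (inj₁ eq) = inj₂ (inj₁ (inj e _ _ eq))
  ... | inj₂ (inj₂ eq) = inj₂ (inj₂ (inj e _ _ eq))
  removable′ : ∀ (X : Sub (size G)) → Nonempty X → HasRemovable′ G X
  removable′ X (w , Xw)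
    with removable (imgSub (fun e) X) (fun e w , trans (imgSub-injective (fun e) (inj e) X w) Xw)
  ... | v , inY , r with imgSub-witness (fun e) X v inY
  ...   | u , Xu , refl =
    u , Xu , RemovableAlong.pull e X (imgSub (fun e) X)
               (imgSub-injective (fun e) (inj e) X) (imgSub-⊆image e X) u r

Strong′-restrict : ∀ {G H} (e : Emb G H) (A : Sub (size G)) (A′ : Sub (size H)) →
  (∀ w → A′ (fun e w) ≡ A w) → (∀ v → A′ v ≡ true → ∃ λ w → fun e w ≡ v) →
  Strong′ H A′ → Strong′ G A
Strong′-restrict {G} {H} e A A′ A′∘e≗A A′⊆image strong B₀ (w₀ , B₀w₀ , Aw₀) =
  pullBack (strong B₀′ (fun e w₀ , trans (imgSub-injective (fun e) (inj e) B₀ w₀) B₀w₀ ,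
                                   trans (A′∘e≗A w₀) Aw₀))
  where
  B₀′ : Sub (size H)
  B₀′ = imgSub (fun e) B₀
  S∘e≗ : ∀ w → (B₀′ (fun e w) ∨ A′ (fun e w)) ≡ (B₀ w ∨ A w)
  S∘e≗ w = cong₂ _∨_ (imgSub-injective (fun e) (inj e) B₀ w) (A′∘e≗A w)
  S⊆image : ∀ v → (B₀′ v ∨ A′ v) ≡ true → ∃ λ w → fun e w ≡ v
  S⊆image v inS with ∨-elim {B₀′ v} inS
  ... | inj₁ inB = imgSub-⊆image e B₀ v inB
  ... | inj₂ inA = A′⊆image v inA
  pullBack : RemovableOutside H A′ B₀′ → RemovableOutside G A B₀
  pullBack (v , inS , A′v , r) with S⊆image v inS
  ... | u , refl =
    u , trans (sym (S∘e≗ u)) inS , trans (sym (A′∘e≗A u)) A′v ,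
    RemovableAlong.pull e (λ v → B₀ v ∨ A v) (λ v → B₀′ v ∨ A′ v) S∘e≗ S⊆image u r

Strong′-∘ : ∀ {B D′ D} (f′ : Emb B D′) (h : Emb D′ D) →
  Strong′ D′ (image f′) → Strong′ D (image h) → Strong′ D (image (h ∘ᴱ f′))
Strong′-∘ {B} {D′} {D} f′ h strong-f′ strong-h B₀ (w₀ , B₀w₀ , w₀∉) =
  byCases (find (λ v → S v ∧ not (image h v)))
  where
  S : Sub (size D)
  S v = B₀ v ∨ image (h ∘ᴱ f′) v

  hf′-h : ∀ w → image (h ∘ᴱ f′) (fun h w) ≡ image f′ w
  hf′-h = img-factor (fun h) (fun f′) _ (inj h) (λ _ → refl)

  outsideH : RemovableOutside D (image h) S → RemovableOutside D (image (h ∘ᴱ f′)) B₀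
  outsideH (u , inS , u∉h , r) =
    u , Su , u∉hf′ , Removable′-⊆ D _ _ u (λ v _ Sv → ∨-introˡ (image h v) Sv) r
    where
    Su : S u ≡ true
    Su with ∨-elim {S u} inS
    ... | inj₁ Su  = Su
    ... | inj₂ u∈h = ⊥-elim (true≢false u∈h u∉h)
    u∉hf′ : image (h ∘ᴱ f′) u ≡ false
    u∉hf′ = ¬true⇒false λ u∈ → let (x , hf′x≡u) = img-witness _ u u∈ in
                                 true≢false (img-intro (fun h) (fun f′ x) hf′x≡u) u∉h

  insideH : (∀ v → S v ≡ true → ∃ λ w → fun h w ≡ v) → RemovableOutside D (image (h ∘ᴱ f′)) B₀
  insideH S⊆h with S⊆h w₀ (∨-introˡ _ B₀w₀)
  ... | w₁ , refl with strong-f′ (λ w → B₀ (fun h w)) (w₁ , B₀w₀ , trans (sym (hf′-h w₁)) w₀∉)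
  ...   | w , inS , w∉f′ , r =
    fun h w , subst (λ t → (B₀ (fun h w) ∨ t) ≡ true) (sym (hf′-h w)) inS , trans (hf′-h w) w∉f′ ,
    RemovableAlong.push h (λ w → B₀ (fun h w) ∨ image f′ w) S
      (λ w → cong (B₀ (fun h w) ∨_) (hf′-h w)) S⊆h w r

  byCases : ∃ (Holds (λ v → S v ∧ not (image h v))) ⊎ (∀ v → (S v ∧ not (image h v)) ≡ false) →
            RemovableOutside D (image (h ∘ᴱ f′)) B₀
  byCases (inj₁ (v , Sv∉h)) =
    let (Sv , v∉h) = ∧-elim {S v} Sv∉h in outsideH (strong-h S (v , Sv , not-true⇒false v∉h))
  byCases (inj₂ none) = insideH S⊆h
    where
    S⊆h : ∀ v → S v ≡ true → ∃ λ w → fun h w ≡ v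
    S⊆h v Sv with image h v in v∈h
    ... | true  = img-witness (fun h) v v∈h
    ... | false = ⊥-elim (true≢false (∧-intro Sv (cong not v∈h)) (none v))

-- One-vertex extensions

adj⇒≢ : ∀ G {a b : Fin (size G)} → adj G a b ≡ true → a ≢ b
adj⇒≢ G {a} ab refl = true≢false ab (adj-irr G a)

adjExtend : (Fin n → Fin n → Bool) → (Fin n → Bool) → Fin (suc n) → Fin (suc n) → Bool
adjExtend a N zero    zero    = false
adjExtend a N zero    (suc v) = N v
adjExtend a N (suc u) zero    = N u
adjExtend a N (suc u) (suc v) = a u v

extend : (D : Graph) → Sub (size D) → Graph
extend D N = record { size = suc (size D) ; adj = adjExtend (adj D) N ; adj-sym = sym′ ; adj-irr = irr }
  where
  sym′ : ∀ x y → adjExtend (adj D) N x y ≡ adjExtend (adj D) N y x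
  sym′ zero    zero    = refl
  sym′ zero    (suc y) = refl
  sym′ (suc x) zero    = refl
  sym′ (suc x) (suc y) = adj-sym D x y
  irr : ∀ x → adjExtend (adj D) N x x ≡ false
  irr zero    = refl
  irr (suc x) = adj-irr D x

common-sym : ∀ G x y z → common G x y z ≡ true → common G y x z ≡ true
common-sym G x y z = ∧-swap {adj G x z}

sucᴱ : ∀ {D} N → Emb D (extend D N)
sucᴱ N = record { fun = suc ; inj = λ x y → fsuc-injective ; adj-pres = λ x y → refl }

-- The extra condition ensures that the new triangle on XY is at most the second one.
Attachable : (D : Graph) → Sub (size D) → Set
Attachable D N = AtMostOne (Holds N) ⊎
  Σ (IsEdge D (Holds N)) λ { (X , Y , _) → AtMostOne (Holds (common D X Y)) }

module Extension (D : Graph) (N : Sub (size D)) where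

  E : Graph
  E = extend D N

  new-SmallClique : Attachable D N → SmallClique E (Holds (adj E zero))
  new-SmallClique (inj₁ ≤1) = inj₁ unique
    where
    unique : AtMostOne (Holds (adj E zero))
    unique (suc a) (suc b) Na Nb = cong suc (≤1 a b Na Nb)
  new-SmallClique (inj₂ ((X , Y , X≢Y , NX , NY , XY , within) , _)) =
    inj₂ (suc X , suc Y , (λ eq → X≢Y (fsuc-injective eq)) , NX , NY , XY , within′)
    where
    within′ : ∀ w → Holds (adj E zero) w → w ≡ suc X ⊎ w ≡ suc Y
    within′ (suc w) Nw with within w Nw
    ... | inj₁ eq = inj₁ (cong suc eq)
    ... | inj₂ eq = inj₂ (cong suc eq)

  new-removable : Attachable D N → ∀ X → Removable′ E X zero
  new-removable attachable X = SmallClique-⊆ E (nbr E X zero) (adj E zero)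
    (λ v n → proj₂ (∧-elim {X v} n)) (new-SmallClique attachable)

  common-N : Attachable D N → ∀ u v → N u ≡ true → N v ≡ true → adj D u v ≡ true →
             AtMostOne (Holds (common D u v))
  common-N (inj₁ ≤1) u v Nu Nv uv = ⊥-elim (adj⇒≢ D uv (≤1 u v Nu Nv))
  common-N (inj₂ ((X , Y , _ , _ , _ , _ , within) , fewCommon)) u v Nu Nv uv =
    byPair (within u Nu) (within v Nv)
    where
    byPair : u ≡ X ⊎ u ≡ Y → v ≡ X ⊎ v ≡ Y → AtMostOne (Holds (common D u v))
    byPair (inj₁ refl) (inj₁ refl) = ⊥-elim (adj⇒≢ D uv refl)
    byPair (inj₂ refl) (inj₂ refl) = ⊥-elim (adj⇒≢ D uv refl)
    byPair (inj₁ refl) (inj₂ refl) = fewCommon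
    byPair (inj₂ refl) (inj₁ refl) a b ca cb =
      fewCommon a b (common-sym D Y X a ca) (common-sym D Y X b cb)

  common-new : Attachable D N → ∀ v → N v ≡ true → AtMostOne (Holds (common E zero (suc v)))
  common-new attachable v Nv (suc a) (suc b) ca cb with ∧-elim {N a} ca | ∧-elim {N b} cb | attachable
  ... | Na , va | Nb , vb | inj₁ ≤1 = ⊥-elim (adj⇒≢ D va (≤1 v a Nv Na))
  ... | Na , va | Nb , vb | inj₂ ((X , Y , _ , _ , _ , _ , within) , _) =
    cong suc (byPair (within v Nv) (within a Na) (within b Nb))
    where
    byPair : v ≡ X ⊎ v ≡ Y → a ≡ X ⊎ a ≡ Y → b ≡ X ⊎ b ≡ Y → a ≡ b
    byPair _           (inj₁ refl) (inj₁ refl) = refl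
    byPair _           (inj₂ refl) (inj₂ refl) = refl
    byPair (inj₁ refl) (inj₁ refl) _           = ⊥-elim (adj⇒≢ D va refl)
    byPair (inj₂ refl) (inj₂ refl) _           = ⊥-elim (adj⇒≢ D va refl)
    byPair (inj₁ refl) (inj₂ refl) (inj₁ refl) = ⊥-elim (adj⇒≢ D vb refl)
    byPair (inj₂ refl) (inj₁ refl) (inj₂ refl) = ⊥-elim (adj⇒≢ D vb refl)

  triangles : Attachable D N → (∀ x y → adj D x y ≡ true → AtMostTwo (Holds (common D x y))) →
              ∀ x y → adj E x y ≡ true → AtMostTwo (Holds (common E x y))
  triangles att tri zero    (suc v) Nv = AtMostOne⇒AtMostTwo (common-new att v Nv)
  triangles att tri (suc u) zero    Nu a b c ca cb cc =
    AtMostOne⇒AtMostTwo (common-new att u Nu) a b c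
      (common-sym E (suc u) zero a ca) (common-sym E (suc u) zero b cb) (common-sym E (suc u) zero c cc)
  triangles att tri (suc u) (suc v) uv = oldEdge
    where
    viaNew : common E (suc u) (suc v) zero ≡ true → AtMostOne (Holds (common D u v))
    viaNew c₀ = let (Nu , Nv) = ∧-elim {N u} c₀ in common-N att u v Nu Nv uv
    oldEdge : AtMostTwo (Holds (common E (suc u) (suc v)))
    oldEdge zero    zero    _       _  _  _  = inj₁ refl
    oldEdge zero    (suc b) zero    _  _  _  = inj₂ (inj₁ refl)
    oldEdge (suc a) zero    zero    _  _  _  = inj₂ (inj₂ refl)
    oldEdge zero    (suc b) (suc c) c₀ cb cc = inj₂ (inj₂ (cong suc (viaNew c₀ b c cb cc)))
    oldEdge (suc a) zero    (suc c) ca c₀ cc = inj₂ (inj₁ (cong suc (viaNew c₀ a c ca cc)))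
    oldEdge (suc a) (suc b) zero    ca cb c₀ = inj₁ (cong suc (viaNew c₀ a b ca cb))
    oldEdge (suc a) (suc b) (suc c) ca cb cc with tri u v uv a b c ca cb cc
    ... | inj₁ eq        = inj₁ (cong suc eq)
    ... | inj₂ (inj₁ eq) = inj₂ (inj₁ (cong suc eq))
    ... | inj₂ (inj₂ eq) = inj₂ (inj₂ (cong suc eq))

  old⊆image : ∀ (X : Sub (size E)) → X zero ≡ false → ∀ v → X v ≡ true → ∃ λ w → suc w ≡ v
  old⊆image X X₀ zero    X₀′ = ⊥-elim (true≢false X₀′ X₀)
  old⊆image X X₀ (suc v) _   = v , refl

  InK′-extend : Attachable D N → InK′ D → InK′ E
  InK′-extend attachable (tri , removable) = triangles attachable tri , removable′
    where
    removable′ : ∀ (X : Sub (size E)) → Nonempty X → HasRemovable′ E X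
    removable′ X (w , Xw) with X zero in X₀
    ... | true  = zero , X₀ , new-removable attachable X
    ... | false with w | Xw
    ...   | zero   | X₀′ = ⊥-elim (true≢false X₀′ X₀)
    ...   | suc w′ | Xw′ with removable (λ v → X (suc v)) (w′ , Xw′)
    ...     | x , Xx , r =
      suc x , Xx ,
      RemovableAlong.push (sucᴱ {D} N) (λ v → X (suc v)) X (λ _ → refl) (old⊆image X X₀) x r

  Strong′-old : Attachable D N → Strong′ E (image (sucᴱ {D} N))
  Strong′-old attachable B₀ (zero , B₀₀ , _) =
    zero , ∨-introˡ _ B₀₀ , img-outside {m = size D} suc zero (λ x ()) , new-removable attachable _
  Strong′-old attachable B₀ (suc w , _ , w∉) =
    ⊥-elim (true≢false (img-intro {m = size D} suc w refl) w∉)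

  withNew : Sub (size D) → Sub (size E)
  withNew Q zero    = true
  withNew Q (suc v) = Q v

  Strong′-withNew : ∀ Q → Strong′ D Q → (∀ v → N v ≡ true → Q v ≡ true) → Strong′ E (withNew Q)
  Strong′-withNew Q strong N⊆Q B₀ (suc w₀ , B₀w₀ , Qw₀)
    with strong (λ v → B₀ (suc v)) (w₀ , B₀w₀ , Qw₀)
  ... | u , inS , Qu , r = suc u , inS , Qu , Removable′-⊆ E S S′ (suc u) S⊆S′ r′
    where
    S S′ : Sub (size E)
    S v = B₀ v ∨ withNew Q v
    S′ zero    = false
    S′ (suc v) = B₀ (suc v) ∨ Q v
    r′ : Removable′ E S′ (suc u)
    r′ = RemovableAlong.push (sucᴱ {D} N) (λ v → B₀ (suc v) ∨ Q v) S′
           (λ _ → refl) (old⊆image S′ refl) u r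
    S⊆S′ : ∀ v → adj E (suc u) v ≡ true → S v ≡ true → S′ v ≡ true
    S⊆S′ zero    Nu _  = ⊥-elim (true≢false (N⊆Q u Nu) Qu)
    S⊆S′ (suc v) _  Sv = Sv

insert : Fin n → (Fin n → Bool) → Fin n → Bool
insert p Q v = ⌊ v ≟ p ⌋ ∨ Q v

insert-≢ : ∀ (Q : Fin n → Bool) {p v} → v ≢ p → insert p Q v ≡ Q v
insert-≢ Q v≢p = cong (_∨ Q _) (≢⇒≟-false v≢p)

-- If p were the removable vertex found, its neighbourhood is {X, Y} ⊆ Q, so every
-- vertex outside Q is non-adjacent to p and p can be discarded from B₀.
Strong′-insert : ∀ G (Q : Sub (size G)) p X Y → Strong′ G Q → Q p ≡ false →
  X ≢ Y → Q X ≡ true → Q Y ≡ true → adj G p X ≡ true → adj G p Y ≡ true →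
  Strong′ G (insert p Q)
Strong′-insert G Q p X Y strong p∉Q X≢Y QX QY pX pY B₀ (w₀ , B₀w₀ , w₀∉) =
  firstTry (strong B₀+p (w₀ , ∨-introˡ _ B₀w₀ , w₀∉Q))
  where
  w₀≢p : w₀ ≢ p
  w₀≢p w₀≡p = true≢false (∨-introˡ (Q w₀) (≡⇒≟-true w₀≡p)) w₀∉
  w₀∉Q : Q w₀ ≡ false
  w₀∉Q = trans (sym (insert-≢ Q w₀≢p)) w₀∉
  B₀+p : Sub (size G)
  B₀+p v = B₀ v ∨ ⌊ v ≟ p ⌋
  S : Sub (size G)
  S v = B₀ v ∨ insert p Q v
  reassoc : ∀ v → (B₀+p v ∨ Q v) ≡ S v
  reassoc v = ∨-assoc (B₀ v) _ (Q v)

  secondTry : (∀ w → Holds (nbr G (λ v → B₀+p v ∨ Q v) p) w → w ≡ X ⊎ w ≡ Y) →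
              RemovableOutside G Q (remove B₀ p) → RemovableOutside G (insert p Q) B₀
  secondTry nbrs-p (u , inS , u∉Q , r) =
    u , ∨-introˡ _ B₀u , trans (insert-≢ Q u≢p) u∉Q , Removable′-⊆ G _ _ u S⊆S′ r
    where
    B₁u : remove B₀ p u ≡ true
    B₁u with ∨-elim {remove B₀ p u} inS
    ... | inj₁ B₁u = B₁u
    ... | inj₂ u∈Q = ⊥-elim (true≢false u∈Q u∉Q)
    B₀u : B₀ u ≡ true
    B₀u = proj₁ (remove-elim B₀ p u B₁u)
    u≢p : u ≢ p
    u≢p u≡p = proj₂ (remove-elim B₀ p u B₁u) (sym u≡p)
    S⊆S′ : ∀ v → adj G u v ≡ true → S v ≡ true → (remove B₀ p v ∨ Q v) ≡ true
    S⊆S′ v uv Sv with v ≟ p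
    ... | yes refl with nbrs-p u (∧-intro (∨-introˡ _ (∨-introˡ _ B₀u)) (trans (adj-sym G p u) uv))
    ...   | inj₁ refl = ⊥-elim (true≢false QX u∉Q)
    ...   | inj₂ refl = ⊥-elim (true≢false QY u∉Q)
    S⊆S′ v uv Sv | no _ with ∨-elim {B₀ v} Sv
    ... | inj₁ B₀v = ∨-introˡ _ (∧-intro B₀v refl)
    ... | inj₂ v∈Q = ∨-introʳ _ v∈Q

  firstTry : RemovableOutside G Q B₀+p → RemovableOutside G (insert p Q) B₀
  firstTry (u , inS , u∉Q , r) = decide (u ≟ p)
    where
    decide : Dec (u ≡ p) → RemovableOutside G (insert p Q) B₀
    decide (no u≢p) =
      u , trans (sym (reassoc u)) inS , trans (insert-≢ Q u≢p) u∉Q ,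
      Removable′-⊆ G _ _ u (λ v _ Sv → trans (reassoc v) Sv) r
    decide (yes u≡p) =
      secondTry (SmallClique-pair G X Y (subst (Removable′ G _) u≡p r)
                   (∧-intro (∨-introʳ _ QX) pX) (∧-intro (∨-introʳ _ QY) pY) X≢Y)
                (strong (remove B₀ p)
                   (w₀ , remove-intro B₀ p w₀ B₀w₀ (λ p≡w₀ → w₀≢p (sym p≡w₀)) , w₀∉Q))

Strong′-full : ∀ G (A : Sub (size G)) → (∀ v → A v ≡ true) → Strong′ G A
Strong′-full G A full B₀ (w , _ , w∉A) = ⊥-elim (true≢false (full w) w∉A)

Strong′-image-id : ∀ G → Strong′ G (image (idᴱ {G}))
Strong′-image-id G = Strong′-full G _ (λ v → img-intro (λ x → x) v refl)

Strong′-neighbourhood : ∀ G (Q : Sub (size G)) p → Strong′ G Q → Q p ≡ false →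
  SmallClique G (Holds (nbr G (insert p Q) p))
Strong′-neighbourhood G Q p strong p∉Q with strong (λ v → ⌊ v ≟ p ⌋) (p , ≡⇒≟-true refl , p∉Q)
... | u , inS , u∉Q , r with ∨-elim {⌊ u ≟ p ⌋} inS
...   | inj₁ u≡p = subst (Removable′ G _) (≟-true⇒≡ u≡p) r
...   | inj₂ u∈Q = ⊥-elim (true≢false u∈Q u∉Q)

record Deletion (C : Graph) (c : Fin (size C)) : Set where
  field
    rest     : Graph
    ι        : Emb rest C
    size-suc : size C ≡ suc (size rest)
    avoids   : ∀ x → fun ι x ≢ c
    covers   : ∀ v → v ≢ c → ∃ λ x → fun ι x ≡ v

delete : (C : Graph) (c : Fin (size C)) → Deletion C c
delete record { size = suc m ; adj = a ; adj-sym = a-sym ; adj-irr = a-irr } c = record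
  { rest     = record { size = m ; adj = λ x y → a (punchIn c x) (punchIn c y)
                      ; adj-sym = λ x y → a-sym _ _ ; adj-irr = λ x → a-irr _ }
  ; ι        = record { fun = punchIn c ; inj = punchIn-injective c ; adj-pres = λ x y → refl }
  ; size-suc = refl
  ; avoids   = punchInᵢ≢i c
  ; covers   = λ v v≢c → punchOut (λ c≡v → v≢c (sym c≡v)) , punchIn-punchOut _
  }

module _ {C : Graph} {c : Fin (size C)} (δ : Deletion C c) where
  open Deletion δ

  factor : ∀ {A} (iC : Emb A C) → (∀ a → fun iC a ≢ c) →
    Σ (Emb A rest) λ iC′ → ∀ a → fun ι (fun iC′ a) ≡ fun iC a
  factor {A} iC avoid = iC′ , ι∘iC′
    where
    pre : Fin (size A) → Fin (size rest)
    pre a = proj₁ (covers (fun iC a) (avoid a))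
    ι∘iC′ : ∀ a → fun ι (pre a) ≡ fun iC a
    ι∘iC′ a = proj₂ (covers (fun iC a) (avoid a))
    iC′ : Emb A rest
    iC′ = record
      { fun      = pre
      ; inj      = λ a b eq → inj iC a b (trans (sym (ι∘iC′ a)) (trans (cong (fun ι) eq) (ι∘iC′ b)))
      ; adj-pres = λ a b → trans (sym (adj-pres ι _ _))
                                 (trans (cong₂ (adj C) (ι∘iC′ a) (ι∘iC′ b)) (adj-pres iC a b))
      }

  module ExtendAt {D : Graph} (m : Emb rest D) (t : Fin (size D)) (t∉m : ∀ x → fun m x ≢ t)
    (t-adj : ∀ x → adj D t (fun m x) ≡ adj C c (fun ι x)) where

    Preimage : Fin (size C) → Set
    Preimage v = v ≡ c ⊎ ∃ λ x → fun ι x ≡ v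

    classify : ∀ v → Preimage v
    classify v with v ≟ c
    ... | yes v≡c = inj₁ v≡c
    ... | no v≢c  = inj₂ (covers v v≢c)

    send : ∀ v → Preimage v → Fin (size D)
    send v (inj₁ _)       = t
    send v (inj₂ (x , _)) = fun m x

    k-fun : Fin (size C) → Fin (size D)
    k-fun v = send v (classify v)

    k-c : k-fun c ≡ t
    k-c with classify c
    ... | inj₁ _       = refl
    ... | inj₂ (x , q) = ⊥-elim (avoids x q)

    k-ι : ∀ x → k-fun (fun ι x) ≡ fun m x
    k-ι x with classify (fun ι x)
    ... | inj₁ q        = ⊥-elim (avoids x q)
    ... | inj₂ (x′ , q) = cong (fun m) (inj ι x′ x q)

    k-inj : ∀ v w → k-fun v ≡ k-fun w → v ≡ w
    k-inj v w eq with classify v | classify w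
    ... | inj₁ refl       | inj₁ refl       = refl
    ... | inj₁ refl       | inj₂ (y , refl) = ⊥-elim (t∉m y (sym eq))
    ... | inj₂ (x , refl) | inj₁ refl       = ⊥-elim (t∉m x eq)
    ... | inj₂ (x , refl) | inj₂ (y , refl) = cong (fun ι) (inj m x y eq)

    k-adj : ∀ v w → adj D (k-fun v) (k-fun w) ≡ adj C v w
    k-adj v w with classify v | classify w
    ... | inj₁ refl       | inj₁ refl       = trans (adj-irr D t) (sym (adj-irr C v))
    ... | inj₁ refl       | inj₂ (y , refl) = t-adj y
    ... | inj₂ (x , refl) | inj₁ refl       = trans (adj-sym D _ _) (trans (t-adj x) (adj-sym C _ _))
    ... | inj₂ (x , refl) | inj₂ (y , refl) = trans (adj-pres m x y) (sym (adj-pres ι x y))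

    k : Emb C D
    k = record { fun = k-fun ; inj = k-inj ; adj-pres = k-adj }

    image-k : ∀ v → image k v ≡ insert t (image m) v
    image-k v = bool-ext to from
      where
      to : image k v ≡ true → insert t (image m) v ≡ true
      to v∈k with img-witness k-fun v v∈k
      ... | u , ku≡v with classify u
      ...   | inj₁ refl       = ∨-introˡ _ (≡⇒≟-true (sym ku≡v))
      ...   | inj₂ (x , refl) = ∨-introʳ _ (img-intro (fun m) x ku≡v)
      from : insert t (image m) v ≡ true → image k v ≡ true
      from v∈ with ∨-elim {⌊ v ≟ t ⌋} v∈
      ... | inj₁ v≡t = img-intro k-fun c (trans k-c (sym (≟-true⇒≡ v≡t)))
      ... | inj₂ v∈m = let (x , mx≡v) = img-witness (fun m) v v∈m in
                       img-intro k-fun (fun ι x) (trans (k-ι x) mx≡v)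

-- Amalgamation

record Amalgam {A B C : Graph} (iB : Emb A B) (iC : Emb A C) : Set where
  constructor mkAmalgam
  field
    D        : Graph
    K-D      : InK′ D
    f        : Emb B D
    g        : Emb C D
    commutes : ∀ a → fun f (fun iB a) ≡ fun g (fun iC a)
    strong-f : Strong′ D (image f)
    strong-g : Strong′ D (image g)

module OnePoint {D′ C : Graph} (K′ : InK′ D′) (KC : InK′ C) {c : Fin (size C)} (δ : Deletion C c)
  (g′ : Emb (Deletion.rest δ) D′) (strong-g′ : Strong′ D′ (image g′)) where
  open Deletion δ

  N : Sub (size D′)
  N = imgSub (fun g′) (λ x → adj C c (fun ι x))

  N-g′ : ∀ x → N (fun g′ x) ≡ adj C c (fun ι x)
  N-g′ = imgSub-injective (fun g′) (inj g′) _

  N⊆image : ∀ v → N v ≡ true → image g′ v ≡ true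
  N⊆image v Nv = let (x , _ , g′x≡v) = imgSub-witness (fun g′) _ v Nv in img-intro (fun g′) x g′x≡v

  adjoin : Attachable D′ N → Amalgam g′ ι
  adjoin attachable =
    mkAmalgam (extend D′ N) (InK′-extend attachable K′) (sucᴱ N) K.k (λ x → sym (K.k-ι x))
    (Strong′-old attachable) $
    Strong′-cong (extend D′ N) (withNew (image g′)) (image K.k) image-withNew
      (Strong′-withNew (image g′) strong-g′ N⊆image)
    where
    open Extension D′ N
    module K = ExtendAt δ (sucᴱ N ∘ᴱ g′) zero (λ x ()) N-g′
    image-withNew : ∀ v → withNew (image g′) v ≡ image K.k v
    image-withNew zero    = sym (K.image-k zero)
    image-withNew (suc v) =
      trans (sym (img-factor suc (fun g′) _ (λ _ _ → fsuc-injective) (λ _ → refl) v))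
            (sym (K.image-k (suc v)))

  module _ (y₀ z₀ : Fin (size rest)) (y₀≢z₀ : y₀ ≢ z₀)
    (cy : adj C c (fun ι y₀) ≡ true) (cz : adj C c (fun ι z₀) ≡ true)
    (yz : adj C (fun ι y₀) (fun ι z₀) ≡ true)
    (within : ∀ w → adj C c w ≡ true → w ≡ fun ι y₀ ⊎ w ≡ fun ι z₀) where

    X Y : Fin (size D′)
    X = fun g′ y₀
    Y = fun g′ z₀

    X≢Y : X ≢ Y
    X≢Y eq = y₀≢z₀ (inj g′ _ _ eq)

    identify : ∀ p → image g′ p ≡ false → adj D′ p X ≡ true → adj D′ p Y ≡ true → Amalgam g′ ι
    identify p p∉ pX pY =
      mkAmalgam D′ K′ idᴱ K.k (λ x → sym (K.k-ι x))
        (Strong′-image-id D′) $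
      Strong′-cong D′ (insert p (image g′)) (image K.k) (λ v → sym (K.image-k v))
        (Strong′-insert D′ (image g′) p X Y strong-g′ p∉ X≢Y X∈ Y∈ pX pY)
      where
      X∈ : image g′ X ≡ true
      X∈ = img-intro (fun g′) y₀ refl
      Y∈ : image g′ Y ≡ true
      Y∈ = img-intro (fun g′) z₀ refl
      nbrs-p : ∀ w → adj D′ p w ≡ true → image g′ w ≡ true → w ≡ X ⊎ w ≡ Y
      nbrs-p w pw w∈ =
        SmallClique-pair D′ X Y (Strong′-neighbourhood D′ (image g′) p strong-g′ p∉)
          (∧-intro (∨-introʳ _ X∈) pX) (∧-intro (∨-introʳ _ Y∈) pY) X≢Y w (∧-intro (∨-introʳ _ w∈) pw)
      p-adj : ∀ x → adj D′ p (fun g′ x) ≡ adj C c (fun ι x)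
      p-adj x = bool-ext to from
        where
        to : adj D′ p (fun g′ x) ≡ true → adj C c (fun ι x) ≡ true
        to px with nbrs-p (fun g′ x) px (img-intro (fun g′) x refl)
        ... | inj₁ eq = subst (λ t → adj C c (fun ι t) ≡ true) (inj g′ _ _ (sym eq)) cy
        ... | inj₂ eq = subst (λ t → adj C c (fun ι t) ≡ true) (inj g′ _ _ (sym eq)) cz
        from : adj C c (fun ι x) ≡ true → adj D′ p (fun g′ x) ≡ true
        from cx with within (fun ι x) cx
        ... | inj₁ eq = subst (λ t → adj D′ p (fun g′ t) ≡ true) (inj ι _ _ (sym eq)) pX
        ... | inj₂ eq = subst (λ t → adj D′ p (fun g′ t) ≡ true) (inj ι _ _ (sym eq)) pY
      module K = ExtendAt δ g′ p (λ x eq → true≢false (img-intro (fun g′) x eq) p∉) p-adj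

    XY : adj D′ X Y ≡ true
    XY = trans (adj-pres g′ y₀ z₀) (trans (sym (adj-pres ι y₀ z₀)) yz)

    withinN : ∀ w → N w ≡ true → w ≡ X ⊎ w ≡ Y
    withinN w Nw with imgSub-witness (fun g′) _ w Nw
    ... | x , cx , refl with within (fun ι x) cx
    ...   | inj₁ eq = inj₁ (cong (fun g′) (inj ι _ _ eq))
    ...   | inj₂ eq = inj₂ (cong (fun g′) (inj ι _ _ eq))

    identifyCommon : ∀ p → image g′ p ≡ false → common D′ X Y p ≡ true → Amalgam g′ ι
    identifyCommon p p∉ cp = let (Xp , Yp) = ∧-elim {adj D′ X p} cp in
      identify p p∉ (trans (adj-sym D′ p X) Xp) (trans (adj-sym D′ p Y) Yp)

    commonInC : ∀ p → common D′ X Y p ≡ true → image g′ p ≡ true →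
                ∃ λ p₀ → fun g′ p₀ ≡ p × common C (fun ι y₀) (fun ι z₀) (fun ι p₀) ≡ true
    commonInC p cp p∈ with img-witness (fun g′) p p∈
    ... | p₀ , refl =
      p₀ , refl , trans (common-emb ι y₀ z₀ p₀) (trans (sym (common-emb g′ y₀ z₀ p₀)) cp)

    -- If both p and q lay in the image of g′, the edge ι y₀ ι z₀ of C would lie in
    -- three triangles, with apexes c, ι p₀ and ι q₀.
    twoCommon : (Σ _ λ p → Σ _ λ q → p ≢ q × common D′ X Y p ≡ true × common D′ X Y q ≡ true) →
                Amalgam g′ ι
    twoCommon (p , q , p≢q , cp , cq) with image g′ p in p∈ | image g′ q in q∈
    ... | false | _     = identifyCommon p p∈ cp
    ... | true  | false = identifyCommon q q∈ cq
    ... | true  | true  with commonInC p cp p∈ | commonInC q cq q∈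
    ...   | p₀ , refl , cp₀ | q₀ , refl , cq₀
          with proj₁ KC (fun ι y₀) (fun ι z₀) yz c (fun ι p₀) (fun ι q₀)
                 (∧-intro (trans (adj-sym C _ _) cy) (trans (adj-sym C _ _) cz)) cp₀ cq₀
    ...     | inj₁ c≡p₀        = ⊥-elim (avoids p₀ (sym c≡p₀))
    ...     | inj₂ (inj₁ c≡q₀) = ⊥-elim (avoids q₀ (sym c≡q₀))
    ...     | inj₂ (inj₂ eq)   = ⊥-elim (p≢q (cong (fun g′) (inj ι _ _ eq)))

    overEdge : Dec (count (common D′ X Y) ≤ 1) → Amalgam g′ ι
    overEdge (yes ≤1) =
      adjoin (inj₂ ((X , Y , X≢Y , trans (N-g′ y₀) cy , trans (N-g′ z₀) cz , XY , withinN) ,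
                    count≤1⇒AtMostOne _ ≤1))
    overEdge (no ≰1)  = twoCommon (count≥2⇒two _ (≰⇒> ≰1))

  reinsert : Removable′ C (λ _ → true) c → Amalgam g′ ι
  reinsert (inj₁ ≤1) = adjoin (inj₁ N≤1)
    where
    N≤1 : AtMostOne (Holds N)
    N≤1 a b Na Nb with imgSub-witness (fun g′) _ a Na | imgSub-witness (fun g′) _ b Nb
    ... | xa , ca , refl | xb , cb , refl = cong (fun g′) (inj ι _ _ (≤1 _ _ ca cb))
  reinsert (inj₂ (y , z , y≢z , cy , cz , yz , within))
    with covers y (λ y≡c → adj⇒≢ C cy (sym y≡c)) | covers z (λ z≡c → adj⇒≢ C cz (sym z≡c))
  ... | y₀ , refl | z₀ , refl =
    overEdge y₀ z₀ (λ eq → y≢z (cong (fun ι) eq)) cy cz yz within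
      (count (common D′ (fun g′ y₀) (fun g′ z₀)) ≤? 1)

Amalgam-onto : ∀ {A B C} (iB : Emb A B) (iC : Emb A C) → InK′ B → Strong′ B (image iB) →
  (∀ v → image iC v ≡ true) → Amalgam iB iC
Amalgam-onto {A} {B} {C} iB iC KB strong-iB onto =
  mkAmalgam B KB idᴱ g agree (Strong′-image-id B) $
  Strong′-cong B (image iB) (image g) image-g strong-iB
  where
  pre : Fin (size C) → Fin (size A)
  pre v = proj₁ (img-witness (fun iC) v (onto v))
  iC∘pre : ∀ v → fun iC (pre v) ≡ v
  iC∘pre v = proj₂ (img-witness (fun iC) v (onto v))
  g : Emb C B
  g = record
    { fun      = λ v → fun iB (pre v)
    ; inj      = λ v w eq → trans (sym (iC∘pre v)) (trans (cong (fun iC) (inj iB _ _ eq)) (iC∘pre w))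
    ; adj-pres = λ v w → trans (adj-pres iB _ _)
                               (trans (sym (adj-pres iC _ _)) (cong₂ (adj C) (iC∘pre v) (iC∘pre w)))
    }
  agree : ∀ a → fun iB a ≡ fun g (fun iC a)
  agree a = cong (fun iB) (inj iC _ _ (sym (iC∘pre (fun iC a))))
  image-g : ∀ v → image iB v ≡ image g v
  image-g v = bool-ext
    (λ v∈ → let (a , iBa≡v) = img-witness (fun iB) v v∈ in
            img-intro (fun g) (fun iC a) (trans (sym (agree a)) iBa≡v))
    (λ v∈ → let (w , gw≡v) = img-witness (fun g) v v∈ in img-intro (fun iB) (pre w) gw≡v)

Amalgam-paste : ∀ {A B C′ C} {iB : Emb A B} {iC′ : Emb A C′} {ι : Emb C′ C} {iC : Emb A C} →
  (∀ a → fun ι (fun iC′ a) ≡ fun iC a) →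
  (am : Amalgam iB iC′) → Amalgam (Amalgam.g am) ι → Amalgam iB iC
Amalgam-paste {iB = iB} {iC′} {ι} {iC} ι∘iC′≗iC
  (mkAmalgam D′ _ f′ g′ commutes′ strong-f′ _) (mkAmalgam D K-D h k commutes strong-h strong-k) =
  mkAmalgam D K-D (h ∘ᴱ f′) k commutes″ (Strong′-∘ f′ h strong-f′ strong-h) strong-k
  where
  commutes″ : ∀ a → fun h (fun f′ (fun iB a)) ≡ fun k (fun iC a)
  commutes″ a = begin
    fun h (fun f′ (fun iB a))   ≡⟨ cong (fun h) (commutes′ a) ⟩
    fun h (fun g′ (fun iC′ a))  ≡⟨ commutes (fun iC′ a) ⟩
    fun k (fun ι (fun iC′ a))   ≡⟨ cong (fun k) (ι∘iC′≗iC a) ⟩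
    fun k (fun iC a)            ∎
    where open ≡-Reasoning

module _ {A B : Graph} (iB : Emb A B) (KB : InK′ B) (strong-iB : Strong′ B (image iB)) where

  amalgamate : ∀ m {C} (iC : Emb A C) → size C ≡ m → InK′ C → Strong′ C (image iC) → Amalgam iB iC
  amalgamate m {C} iC size≡m KC strong-iC with find (λ v → not (image iC v))
  ... | inj₂ none = Amalgam-onto iB iC KB strong-iB (λ v → not-injective (none v))
  ... | inj₁ (v₀ , v₀∉) with strong-iC (λ _ → true) (v₀ , refl , not-true⇒false v₀∉)
  ...   | c , _ , c∉ , removable = byInduction m size≡m
    where
    open Deletion (delete C c)
    iC′,ι∘iC′ : Σ (Emb A rest) λ iC′ → ∀ a → fun ι (fun iC′ a) ≡ fun iC a
    iC′,ι∘iC′ = factor (delete C c) iC λ a iCa≡c → true≢false (img-intro (fun iC) a iCa≡c) c∉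
    iC′ : Emb A rest
    iC′ = proj₁ iC′,ι∘iC′
    ι∘iC′ : ∀ a → fun ι (fun iC′ a) ≡ fun iC a
    ι∘iC′ = proj₂ iC′,ι∘iC′
    image-iC⊆ι : ∀ v → image iC v ≡ true → ∃ λ w → fun ι w ≡ v
    image-iC⊆ι v v∈ =
      let (a , iCa≡v) = img-witness (fun iC) v v∈ in fun iC′ a , trans (ι∘iC′ a) iCa≡v
    strong-iC′ : Strong′ rest (image iC′)
    strong-iC′ = Strong′-restrict ι (image iC′) (image iC)
                   (img-factor (fun ι) (fun iC′) (fun iC) (inj ι) ι∘iC′) image-iC⊆ι strong-iC
    byInduction : ∀ m → size C ≡ m → Amalgam iB iC
    byInduction zero    size≡0 with trans (sym size-suc) size≡0
    ... | ()
    byInduction (suc m′) size≡m = Amalgam-paste ι∘iC′ am $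
      OnePoint.reinsert (Amalgam.K-D am) KC (delete C c) (Amalgam.g am) (Amalgam.strong-g am) removable
      where
      am : Amalgam iB iC′
      am = amalgamate m′ iC′ (suc-injective (trans (sym size-suc) size≡m))
                      (InK′-hereditary ι KC) strong-iC′

proposition2p11 : (A B C : Graph) → InK A → InK B → InK C →
    (iB : Emb A B) (iC : Emb A C) →
    Strong B (image iB) → Strong C (image iC) →
    Σ Graph λ D → InK D × Σ (Emb B D) λ f → Σ (Emb C D) λ g →
      (∀ a → fun f (fun iB a) ≡ fun g (fun iC a)) ×
      Strong D (image f) × Strong D (image g)
proposition2p11 A B C _ KB KC iB iC sB sC =
  D , InK′⇒InK D K-D , f , g , commutes , Strong′⇒Strong D _ strong-f , Strong′⇒Strong D _ strong-g
  where
  open Amalgam (amalgamate iB (InK⇒InK′ B KB) (Strong⇒Strong′ B _ sB)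
                  (size C) iC refl (InK⇒InK′ C KC) (Strong⇒Strong′ C _ sC))
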